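{- Let $\tilde\alpha,\tilde\beta:\mathbb{Q}^3\to\mathbb{Q}^3$ be the bijections $\tilde\alpha(x,y,z)=(x,z,xz-y)$ and $\tilde\beta(x,y,z)=(y,z,x)$, and let $\widetilde G=\langle\tilde\alpha,\tilde\beta\rangle$. If $(x,y,z)$ lies in the orbit $\widetilde G(3,4,4)=\{\tilde g(3,4,4)\mid \tilde g\in\widetilde G\}$, then all six permutations of $(x,y,z)$ also lie in $\widetilde G(3,4,4)$. -}

module Defs where

open import Data.Rational using (ℚ; _+_; _*_; _-_)
open import Data.Product using (_×_; _,_; Σ)
open import Relation.Binary.PropositionalEquality using (_≡_)
import Data.Rational as ℚ
import Data.Integer as ℤ

ℚ³ : Set
ℚ³ = ℚ × ℚ × ℚ

α̃ : ℚ³ → ℚ³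
α̃ (x , y , z) = (x , z , x * z - y)

α̃⁻¹ : ℚ³ → ℚ³
α̃⁻¹ (x , y , z) = (x , x * y - z , y)

β̃ : ℚ³ → ℚ³
β̃ (x , y , z) = (y , z , x)

β̃⁻¹ : ℚ³ → ℚ³
β̃⁻¹ (x , y , z) = (z , x , y)

-- Elements of G̃ = ⟨α̃, β̃⟩ are exactly finite words in α̃^{±1}, β̃^{±1}.
data Word : Set where
  ε    : Word
  α∷_  : Word → Word
  α⁻∷_ : Word → Word
  β∷_  : Word → Word
  β⁻∷_ : Word → Word

⟦_⟧ : Word → ℚ³ → ℚ³
⟦ ε ⟧ p = p
⟦ α∷ w ⟧ p = α̃ (⟦ w ⟧ p)
⟦ α⁻∷ w ⟧ p = α̃⁻¹ (⟦ w ⟧ p)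
⟦ β∷ w ⟧ p = β̃ (⟦ w ⟧ p)
⟦ β⁻∷ w ⟧ p = β̃⁻¹ (⟦ w ⟧ p)

p₀ : ℚ³
p₀ = (ℤ.+ 3 ℚ./ 1 , ℤ.+ 4 ℚ./ 1 , ℤ.+ 4 ℚ./ 1)

_∈Orbit : ℚ³ → Set
p ∈Orbit = Σ Word (λ w → ⟦ w ⟧ p₀ ≡ p)

{-# OPTIONS --safe #-}
module Submission where

-- The transposition of the last two coordinates conjugates α̃ and β̃ to their
-- inverses and fixes (3,4,4), so it maps the orbit onto itself; together with
-- the 3-cycle β̃ it generates every permutation of the coordinates.

open import Defs
open import Data.Rational using (ℚ)
open import Data.Product using (_×_; _,_)
open import Relation.Binary.PropositionalEquality using (_≡_; refl; cong; sym; trans)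
open Relation.Binary.PropositionalEquality.≡-Reasoning

swap₂₃ : ℚ³ → ℚ³
swap₂₃ (x , y , z) = (x , z , y)

swap₂₃-α̃ : ∀ q → swap₂₃ (α̃ q) ≡ α̃⁻¹ (swap₂₃ q)
swap₂₃-α̃ (x , y , z) = refl

swap₂₃-α̃⁻¹ : ∀ q → swap₂₃ (α̃⁻¹ q) ≡ α̃ (swap₂₃ q)
swap₂₃-α̃⁻¹ (x , y , z) = refl

swap₂₃-β̃ : ∀ q → swap₂₃ (β̃ q) ≡ β̃⁻¹ (swap₂₃ q)
swap₂₃-β̃ (x , y , z) = refl

swap₂₃-β̃⁻¹ : ∀ q → swap₂₃ (β̃⁻¹ q) ≡ β̃ (swap₂₃ q)
swap₂₃-β̃⁻¹ (x , y , z) = refl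

invertLetters : Word → Word
invertLetters ε = ε
invertLetters (α∷ w) = α⁻∷ invertLetters w
invertLetters (α⁻∷ w) = α∷ invertLetters w
invertLetters (β∷ w) = β⁻∷ invertLetters w
invertLetters (β⁻∷ w) = β∷ invertLetters w

⟦invertLetters⟧-swap₂₃ : ∀ w p → ⟦ invertLetters w ⟧ (swap₂₃ p) ≡ swap₂₃ (⟦ w ⟧ p)
⟦invertLetters⟧-swap₂₃ ε p = refl
⟦invertLetters⟧-swap₂₃ (α∷ w) p =
  trans (cong α̃⁻¹ (⟦invertLetters⟧-swap₂₃ w p)) (sym (swap₂₃-α̃ (⟦ w ⟧ p)))
⟦invertLetters⟧-swap₂₃ (α⁻∷ w) p =
  trans (cong α̃ (⟦invertLetters⟧-swap₂₃ w p)) (sym (swap₂₃-α̃⁻¹ (⟦ w ⟧ p)))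
⟦invertLetters⟧-swap₂₃ (β∷ w) p =
  trans (cong β̃⁻¹ (⟦invertLetters⟧-swap₂₃ w p)) (sym (swap₂₃-β̃ (⟦ w ⟧ p)))
⟦invertLetters⟧-swap₂₃ (β⁻∷ w) p =
  trans (cong β̃ (⟦invertLetters⟧-swap₂₃ w p)) (sym (swap₂₃-β̃⁻¹ (⟦ w ⟧ p)))

swap₂₃-p₀ : swap₂₃ p₀ ≡ p₀
swap₂₃-p₀ = refl

∈Orbit-swap₂₃ : ∀ {p} → p ∈Orbit → swap₂₃ p ∈Orbit
∈Orbit-swap₂₃ {p} (w , w·p₀≡p) = invertLetters w , (begin
  ⟦ invertLetters w ⟧ p₀            ≡⟨ cong ⟦ invertLetters w ⟧ (sym swap₂₃-p₀) ⟩
  ⟦ invertLetters w ⟧ (swap₂₃ p₀)   ≡⟨ ⟦invertLetters⟧-swap₂₃ w p₀ ⟩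
  swap₂₃ (⟦ w ⟧ p₀)                 ≡⟨ cong swap₂₃ w·p₀≡p ⟩
  swap₂₃ p                          ∎)

∈Orbit-β̃ : ∀ {p} → p ∈Orbit → β̃ p ∈Orbit
∈Orbit-β̃ (w , w·p₀≡p) = β∷ w , cong β̃ w·p₀≡p

∈Orbit-β̃⁻¹ : ∀ {p} → p ∈Orbit → β̃⁻¹ p ∈Orbit
∈Orbit-β̃⁻¹ (w , w·p₀≡p) = β⁻∷ w , cong β̃⁻¹ w·p₀≡p

lemma3p3 : (x y z : ℚ) → (x , y , z) ∈Orbit →
    ((x , y , z) ∈Orbit) × ((x , z , y) ∈Orbit) × ((y , x , z) ∈Orbit) ×
    ((y , z , x) ∈Orbit) × ((z , x , y) ∈Orbit) × ((z , y , x) ∈Orbit)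
lemma3p3 x y z xyz =
    xyz
  , ∈Orbit-swap₂₃ xyz
  , ∈Orbit-swap₂₃ (∈Orbit-β̃ xyz)
  , ∈Orbit-β̃ xyz
  , ∈Orbit-β̃⁻¹ xyz
  , ∈Orbit-swap₂₃ (∈Orbit-β̃⁻¹ xyz)
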